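{- Any digraph that has sign symmetric $P_{0,1}^+$-completion also has sign symmetric $P_{0,1}$-completion.
   Context: A real $n\times n$ matrix is a $P_0$-matrix if every principal minor is nonnegative; a $P_{0,1}$-matrix is a $P_0$-matrix with positive diagonal entries. A real $n\times n$ matrix is a $P_0^+$-matrix if for each $k\in\{1,\dots,n\}$ every $k\times k$ principal minor is nonnegative and at least one $k\times k$ principal minor is positive; a $P_{0,1}^+$-matrix is a $P_0^+$-matrix with positive diagonal entries. A matrix is sign symmetric if for all $i\neq j$, either $a_{ij}a_{ji}>0$ or $a_{ij}=a_{ji}=0$. A partial matrix (some entries specified, others unspecified) specifies a digraph $D$ (loops allowed) if entry $(i,j)$ is specified exactly when $(v_i,v_j)$ is an arc of $D$ (diagonal entries correspond to loops). A partial sign symmetric $P_{0,1}^+$-matrix (resp. $P_{0,1}$-matrix) is a partial matrix whose specified diagonal entries are positive, whose fully specified pairs of twin entries satisfy the sign symmetry condition, and whose fully specified principal minors are nonnegative (with the full conditions holding if the matrix is fully specified). A digraph has sign symmetric $P_{0,1}^+$-completion (resp. $P_{0,1}$-completion) if every partial sign symmetric $P_{0,1}^+$-matrix (resp. $P_{0,1}$-matrix) specifying it can be completed, by choosing values of the unspecified entries, to a sign symmetric $P_{0,1}^+$-matrix (resp. $P_{0,1}$-matrix). -}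

module Defs where

open import Level using (0ℓ)
open import Data.Nat as ℕ using (ℕ; zero; suc)
open import Data.Fin as Fin using (Fin; zero; suc; punchIn)
open import Data.Bool using (Bool; T)
open import Data.Product using (Σ; _×_; _,_)
open import Data.Sum using (_⊎_)
open import Relation.Nullary using (¬_)
open import Relation.Binary.PropositionalEquality using (_≡_)
open import Algebra.Structures using (IsCommutativeRing)
open import Relation.Binary.Structures using (IsStrictTotalOrder)

-- The real numbers, axiomatised as a complete ordered field
-- (unique up to isomorphism, so this is "the" real field ℝ).

record Reals : Set₁ where
  infixl 6 _+_
  infixl 7 _*_
  infix 4 _<_ _≤_
  field
    ℝ    : Set
    0r 1r : ℝ
    _+_ _*_ : ℝ → ℝ → ℝ
    -_   : ℝ → ℝ
    _<_  : ℝ → ℝ → Set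
    isCommutativeRing : IsCommutativeRing _≡_ _+_ _*_ -_ 0r 1r
    0≢1  : ¬ (0r ≡ 1r)
    inverse : ∀ x → ¬ (x ≡ 0r) → Σ ℝ (λ y → x * y ≡ 1r)
    isStrictTotalOrder : IsStrictTotalOrder _≡_ _<_
    +-mono-< : ∀ {x y} z → x < y → x + z < y + z
    *-pos    : ∀ {x y} → 0r < x → 0r < y → 0r < x * y

  _≤_ : ℝ → ℝ → Set
  x ≤ y = x < y ⊎ x ≡ y

  field
    sup : (S : ℝ → Set) → Σ ℝ S → Σ ℝ (λ b → ∀ x → S x → x ≤ b) →
          Σ ℝ (λ s → (∀ x → S x → x ≤ s) ×
                     (∀ b → (∀ x → S x → x ≤ b) → s ≤ b))

module _ (R : Reals) where
  open Reals R

  Matrix : ℕ → Set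
  Matrix n = Fin n → Fin n → ℝ

  sumFin : ∀ {n} → (Fin n → ℝ) → ℝ
  sumFin {zero}  f = 0r
  sumFin {suc n} f = f zero + sumFin (λ i → f (suc i))

  sgn : ∀ {n} → Fin n → ℝ
  sgn zero    = 1r
  sgn (suc j) = - sgn j

  det : ∀ {n} → Matrix n → ℝ
  det {zero}  M = 1r
  det {suc n} M =
    sumFin (λ j → sgn j * M zero j * det (λ a b → M (suc a) (punchIn j b)))

  -- strictly increasing index maps Fin k → Fin n encode k-subsets of Fin n
  Increasing : ∀ {k n} → (Fin k → Fin n) → Set
  Increasing ks = ∀ a b → a Fin.< b → ks a Fin.< ks b

  principal : ∀ {k n} → Matrix n → (Fin k → Fin n) → Matrix k
  principal M ks a b = M (ks a) (ks b)

  IsP0 : ∀ {n} → Matrix n → Set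
  IsP0 {n} M = ∀ k (ks : Fin k → Fin n) → Increasing ks →
               0r ≤ det (principal M ks)

  IsP0+ : ∀ {n} → Matrix n → Set
  IsP0+ {n} M = IsP0 M ×
    (∀ k → 1 ℕ.≤ k → k ℕ.≤ n →
       Σ (Fin k → Fin n) (λ ks → Increasing ks × (0r < det (principal M ks))))

  PosDiag : ∀ {n} → Matrix n → Set
  PosDiag M = ∀ i → 0r < M i i

  SignSymmetric : ∀ {n} → Matrix n → Set
  SignSymmetric M = ∀ i j → ¬ (i ≡ j) →
    (0r < M i j * M j i) ⊎ (M i j ≡ 0r × M j i ≡ 0r)

  IsSSP01 : ∀ {n} → Matrix n → Set
  IsSSP01 M = IsP0 M × PosDiag M × SignSymmetric M

  IsSSP01+ : ∀ {n} → Matrix n → Set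
  IsSSP01+ M = IsP0+ M × PosDiag M × SignSymmetric M

Digraph : ℕ → Set
Digraph n = Fin n → Fin n → Bool   -- D i j = true iff (v_i , v_j) is an arc

module _ (R : Reals) where
  open Reals R

  -- a partial matrix specifying D: entry (i,j) given exactly when (i,j) is an arc
  PartialMatrix : ∀ {n} → Digraph n → Set
  PartialMatrix {n} D = (i j : Fin n) → T (D i j) → ℝ

  FullySpecified : ∀ {n} → Digraph n → Set
  FullySpecified {n} D = ∀ (i j : Fin n) → T (D i j)

  toMatrix : ∀ {n} {D : Digraph n} → PartialMatrix D → FullySpecified D → Matrix R n
  toMatrix A f i j = A i j (f i j)

  IsPartialSSP01 : ∀ {n} (D : Digraph n) → PartialMatrix D → Set
  IsPartialSSP01 {n} D A =
    (∀ i (p : T (D i i)) → 0r < A i i p) ×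
    (∀ i j → ¬ (i ≡ j) → (p : T (D i j)) (q : T (D j i)) →
       (0r < A i j p * A j i q) ⊎ (A i j p ≡ 0r × A j i q ≡ 0r)) ×
    (∀ k (ks : Fin k → Fin n) → Increasing R ks →
       (s : ∀ a b → T (D (ks a) (ks b))) →
       0r ≤ det R (λ a b → A (ks a) (ks b) (s a b)))

  IsPartialSSP01+ : ∀ {n} (D : Digraph n) → PartialMatrix D → Set
  IsPartialSSP01+ D A =
    IsPartialSSP01 D A × ((f : FullySpecified D) → IsSSP01+ R (toMatrix A f))

  Completes : ∀ {n} {D : Digraph n} → PartialMatrix D → Matrix R n → Set
  Completes {n} {D} A B = ∀ i j (p : T (D i j)) → B i j ≡ A i j p

  HasSSP01Completion : ∀ {n} → Digraph n → Set
  HasSSP01Completion D =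
    ∀ (A : PartialMatrix D) → IsPartialSSP01 D A →
      Σ (Matrix R _) (λ B → Completes A B × IsSSP01 R B)

  HasSSP01+Completion : ∀ {n} → Digraph n → Set
  HasSSP01+Completion D =
    ∀ (A : PartialMatrix D) → IsPartialSSP01+ D A →
      Σ (Matrix R _) (λ B → Completes A B × IsSSP01+ R B)

{-# OPTIONS --safe #-}
module Submission where

open import Defs
open import Data.Nat using (ℕ)
open import Data.Bool.Properties using (T?; T-irrelevant)
open import Data.Fin.Properties using (all?)
open import Data.Product using (_,_)
open import Relation.Nullary using (Dec; yes; no; ¬_; contradiction)
open import Relation.Binary.PropositionalEquality using (cong)

-- The two notions of partial matrix differ only when every entry is specified.
-- If D is complete, the partial matrix already is a sign symmetric P₀,₁-matrix;
-- otherwise it is a partial sign symmetric P₀,₁⁺-matrix, and any P₀,₁⁺-completion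
-- of it is in particular a P₀,₁-completion.

module _ (R : Reals) {n : ℕ} {D : Digraph n} where

  fullySpecified? : Dec (FullySpecified R D)
  fullySpecified? = all? λ i → all? λ j → T? (D i j)

  toMatrix-completes : (A : PartialMatrix R D) (f : FullySpecified R D) →
                       Completes R A (toMatrix R A f)
  toMatrix-completes A f i j p = cong (A i j) (T-irrelevant (f i j) p)

  toMatrix-isSSP01 : {A : PartialMatrix R D} (f : FullySpecified R D) →
                     IsPartialSSP01 R D A → IsSSP01 R (toMatrix R A f)
  toMatrix-isSSP01 f (posDiag , signSym , minors≥0) =
      (λ k ks inc → minors≥0 k ks inc (λ a b → f (ks a) (ks b)))
    , (λ i → posDiag i (f i i))
    , (λ i j i≢j → signSym i j i≢j (f i j) (f j i))

  partialSSP01⇒partialSSP01+ : {A : PartialMatrix R D} → ¬ FullySpecified R D →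
                               IsPartialSSP01 R D A → IsPartialSSP01+ R D A
  partialSSP01⇒partialSSP01+ ¬full isPartial =
    isPartial , λ full → contradiction full ¬full

isSSP01+⇒isSSP01 : (R : Reals) {n : ℕ} {M : Matrix R n} →
                   IsSSP01+ R M → IsSSP01 R M
isSSP01+⇒isSSP01 R ((isP0 , _) , posDiag , signSym) = isP0 , posDiag , signSym

theorem4p4 : (R : Reals) (n : ℕ) (D : Digraph n) →
    HasSSP01+Completion R D → HasSSP01Completion R D
theorem4p4 R n D complete+ A isPartial with fullySpecified? R
... | yes full = toMatrix R A full
               , toMatrix-completes R A full
               , toMatrix-isSSP01 R full isPartial
... | no ¬full =
  let B , completes , isSSP01+ = complete+ A (partialSSP01⇒partialSSP01+ R ¬full isPartial)
  in  B , completes , isSSP01+⇒isSSP01 R isSSP01+
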